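{- Let $w_1,\dots,w_n$ be positive integers and $\sigma$ any lexical order on $\{1,\dots,n\}$. Let $r\in[0,w_1-1]$ be such that $\mathsf{sol}_m(r,\sigma)\ne\emptyset$, and let $x\in\mathsf{supp}(\mathsf{sol}_m(r,\sigma))$. Write $\mathsf{sol}_m(r,\sigma)=(u_1,\dots,u_n)$ and define $v=(v_1,\dots,v_n)$ by $v_k=u_k$ for $k\ne x$ and $v_x=u_x-1$. Then $\mathsf{sol}_m((r-w_x)\bmod w_1,\sigma)=v$.
   Context: A solution to a sum $c$ is $m\in\mathbb{N}^n$ with $\sum_i w_im_i=c$; $c$ is feasible if one exists. $\mathsf{supp}(m)=\{i\mid m_i>0\}$. A lexical order $\sigma$ is a permutation of $\{1,\dots,n\}$; solution $A$ is lexicographically smaller than $B$ under $\sigma$ if there is $j$ with $a_{\sigma_k}=b_{\sigma_k}$ for all $k<j$ and $a_{\sigma_j}>b_{\sigma_j}$. $\mathsf{sol}(j,\sigma)$ is the lexicographically smallest solution to $j$ under $\sigma$ (all solutions of a given sum are considered optimal). For $r\in[0,w_1-1]$, $\mathsf{sol}_m(r,\sigma)$ is $\mathsf{sol}(j,\sigma)$ for the minimum feasible $j\ge0$ with $j\equiv r\pmod{w_1}$, or $\emptyset$ if no such $j$ exists. -}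

module Defs where

open import Data.Nat using (ℕ; zero; suc; _+_; _*_; _∸_; _<_; _>_)
open import Data.Nat.DivMod using (_%_)
open import Data.Fin using (Fin; zero; suc) renaming (_<_ to _<ᶠ_)
open import Data.Fin.Permutation using (Permutation′; _⟨$⟩ʳ_)
open import Data.Product using (Σ; _×_; ∃; ∃-syntax)
open import Data.Sum using (_⊎_)
open import Relation.Binary.PropositionalEquality using (_≡_)
open import Relation.Nullary using (¬_; yes; no)
import Data.Fin

weighted : ∀ {n} → (Fin n → ℕ) → (Fin n → ℕ) → ℕ
weighted {zero}  w m = 0
weighted {suc n} w m = w zero * m zero + weighted (λ i → w (suc i)) (λ i → m (suc i))

IsSolution : ∀ {n} → (Fin n → ℕ) → ℕ → (Fin n → ℕ) → Set
IsSolution w c m = weighted w m ≡ c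

Feasible : ∀ {n} → (Fin n → ℕ) → ℕ → Set
Feasible w c = ∃[ m ] IsSolution w c m

-- A is lexicographically smaller than B under σ (paper's convention:
-- at the first differing position σ_j, a_{σ_j} > b_{σ_j})
LexSmaller : ∀ {n} → Permutation′ n → (Fin n → ℕ) → (Fin n → ℕ) → Set
LexSmaller σ a b =
  ∃[ j ] ((∀ k → k <ᶠ j → a (σ ⟨$⟩ʳ k) ≡ b (σ ⟨$⟩ʳ k)) × a (σ ⟨$⟩ʳ j) > b (σ ⟨$⟩ʳ j))

IsSol : ∀ {n} → (Fin n → ℕ) → ℕ → Permutation′ n → (Fin n → ℕ) → Set
IsSol w c σ m =
  IsSolution w c m ×
  (∀ m' → IsSolution w c m' → (∀ i → m' i ≡ m i) ⊎ LexSmaller σ m m')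

mod : ℕ → (b : ℕ) → 0 < b → ℕ
mod a (suc b) _ = a % suc b

-- m = sol_m(r, σ) (in particular sol_m(r, σ) ≠ ∅), weights indexed by Fin (suc k),
-- w_1 = w zero
IsSolM : ∀ {k} (w : Fin (suc k) → ℕ) → 0 < w zero → ℕ → Permutation′ (suc k) →
         (Fin (suc k) → ℕ) → Set
IsSolM w p r σ m =
  Σ ℕ λ j →
    mod j (w zero) p ≡ r × Feasible w j ×
    (∀ j' → j' < j → mod j' (w zero) p ≡ r → ¬ Feasible w j') ×
    IsSol w j σ m

decAt : ∀ {n} → Fin n → (Fin n → ℕ) → Fin n → ℕ
decAt x u i with i Data.Fin.≟ x
... | yes _ = u i ∸ 1
... | no  _ = u i

{-# OPTIONS --safe #-}
-- Removing one unit of the coin x from a solution lowers its sum by w_x, and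
-- adding it back is a bijection between the solutions of c and those
-- solutions of c + w_x that use x; this bijection preserves the
-- lexicographic comparison. Hence sol(j, σ) minus one x is sol(j − w_x, σ),
-- and j − w_x is the least feasible sum in its residue class, since a
-- smaller feasible sum there would give, after adding x, a smaller feasible
-- sum in the class of j.
module Submission where

open import Defs
open import Data.Nat using (ℕ; zero; suc; _+_; _*_; _∸_; _<_; _>_; _%_; NonZero; s<s⁻¹)
open import Data.Nat.Properties
  using (+-commutativeSemigroup; +-assoc; *-suc; suc-injective; +-cancelˡ-≡; +-∸-assoc; m≤m*n; m+n∸m≡n; +-monoʳ-<)
open import Algebra.Properties.CommutativeSemigroup +-commutativeSemigroup using (x∙yz≈y∙xz; x∙yz≈z∙yx)
open import Data.Nat.DivMod using (%-distribˡ-+; [m+kn]%n≡m%n; m<n⇒m%n≡m)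
open import Data.Fin using (Fin; zero; suc; _≟_)
import Data.Fin.Properties as Finₚ
open import Data.Fin.Permutation using (Permutation′; _⟨$⟩ʳ_)
open import Data.Vec.Functional using (updateAt)
open import Data.Vec.Functional.Properties using (updateAt-updates; updateAt-minimal)
open import Data.Product using (_,_; proj₁; proj₂)
open import Data.Sum using (_⊎_; inj₁; inj₂)
open import Function.Bundles using (_⇔_; mk⇔; Equivalence)
open import Relation.Nullary using (¬_; yes; no; contradiction)
open import Relation.Binary.PropositionalEquality

record OneMoreAt {n} (x : Fin n) (a b : Fin n → ℕ) : Set where
  field
    at        : a x ≡ suc (b x)
    elsewhere : ∀ i → i ≢ x → a i ≡ b i

updateAt-suc-oneMoreAt : ∀ {n} (x : Fin n) (m : Fin n → ℕ) → OneMoreAt x (updateAt m x suc) m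
updateAt-suc-oneMoreAt x m = record
  { at        = updateAt-updates x m
  ; elsewhere = λ i i≢x → updateAt-minimal i x m i≢x
  }

decAt-oneMoreAt : ∀ {n} (x : Fin n) (u : Fin n → ℕ) → 0 < u x → OneMoreAt x u (decAt x u)
decAt-oneMoreAt x u 0<ux = record { at = at ; elsewhere = elsewhere }
  where
  at : u x ≡ suc (decAt x u x)
  at with x ≟ x
  ... | yes _   = m≡suc[m∸1] 0<ux
    where
    m≡suc[m∸1] : ∀ {m} → 0 < m → m ≡ suc (m ∸ 1)
    m≡suc[m∸1] {suc _} _ = refl
  ... | no  x≢x = contradiction refl x≢x

  elsewhere : ∀ i → i ≢ x → u i ≡ decAt x u i
  elsewhere i i≢x with i ≟ x
  ... | yes i≡x = contradiction i≡x i≢x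
  ... | no  _   = refl

weighted-cong : ∀ {n} (w : Fin n → ℕ) {a b : Fin n → ℕ} →
                (∀ i → a i ≡ b i) → weighted w a ≡ weighted w b
weighted-cong {zero}  w a≗b = refl
weighted-cong {suc n} w a≗b =
  cong₂ _+_ (cong (w zero *_) (a≗b zero)) (weighted-cong (λ i → w (suc i)) (λ i → a≗b (suc i)))

weighted-oneMoreAt : ∀ {n} (w : Fin n → ℕ) {x : Fin n} {a b : Fin n → ℕ} →
                     OneMoreAt x a b → weighted w a ≡ w x + weighted w b
weighted-oneMoreAt {suc n} w {zero} {a} {b} a≻b = begin
  w zero * a zero + weighted w′ (λ i → a (suc i))
    ≡⟨ cong₂ _+_ (cong (w zero *_) at) (weighted-cong w′ (λ i → elsewhere (suc i) λ ())) ⟩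
  w zero * suc (b zero) + weighted w′ (λ i → b (suc i))
    ≡⟨ cong (_+ weighted w′ (λ i → b (suc i))) (*-suc (w zero) (b zero)) ⟩
  w zero + w zero * b zero + weighted w′ (λ i → b (suc i))
    ≡⟨ +-assoc (w zero) _ _ ⟩
  w zero + weighted w b ∎
  where
  open ≡-Reasoning
  open OneMoreAt a≻b
  w′ : Fin n → ℕ
  w′ i = w (suc i)
weighted-oneMoreAt {suc n} w {suc x} {a} {b} a≻b = begin
  w zero * a zero + weighted w′ (λ i → a (suc i))
    ≡⟨ cong₂ _+_ (cong (w zero *_) (elsewhere zero λ ())) (weighted-oneMoreAt w′ tail≻) ⟩
  w zero * b zero + (w (suc x) + weighted w′ (λ i → b (suc i)))
    ≡⟨ x∙yz≈y∙xz (w zero * b zero) (w (suc x)) _ ⟩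
  w (suc x) + weighted w b ∎
  where
  open ≡-Reasoning
  open OneMoreAt a≻b
  w′ : Fin n → ℕ
  w′ i = w (suc i)
  tail≻ : OneMoreAt x (λ i → a (suc i)) (λ i → b (suc i))
  tail≻ = record
    { at        = at
    ; elsewhere = λ i i≢x → elsewhere (suc i) (λ e → i≢x (Finₚ.suc-injective e))
    }

module _ {n} {x : Fin n} {a b a′ b′ : Fin n → ℕ}
         (a≻b : OneMoreAt x a b) (a′≻b′ : OneMoreAt x a′ b′) where
  open OneMoreAt

  oneMoreAt-≡ : ∀ i → a i ≡ a′ i → b i ≡ b′ i
  oneMoreAt-≡ i ai≡a′i with i ≟ x
  ... | yes refl = suc-injective (trans (sym (at a≻b)) (trans ai≡a′i (at a′≻b′)))
  ... | no  i≢x  = trans (sym (elsewhere a≻b i i≢x)) (trans ai≡a′i (elsewhere a′≻b′ i i≢x))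

  oneMoreAt-> : ∀ i → a i > a′ i → b i > b′ i
  oneMoreAt-> i ai>a′i with i ≟ x
  ... | yes refl = s<s⁻¹ (subst₂ _>_ (at a≻b) (at a′≻b′) ai>a′i)
  ... | no  i≢x  = subst₂ _>_ (elsewhere a≻b i i≢x) (elsewhere a′≻b′ i i≢x) ai>a′i

  LexSmaller-oneMoreAt : (σ : Permutation′ n) → LexSmaller σ a a′ → LexSmaller σ b b′
  LexSmaller-oneMoreAt σ (j , agree , differ) =
    j , (λ k k<j → oneMoreAt-≡ (σ ⟨$⟩ʳ k) (agree k k<j)) , oneMoreAt-> (σ ⟨$⟩ʳ j) differ

Feasible-+ : ∀ {n} (w : Fin n → ℕ) (x : Fin n) {c : ℕ} → Feasible w c → Feasible w (w x + c)
Feasible-+ w x (m , m-sol) =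
  updateAt m x suc , trans (weighted-oneMoreAt w (updateAt-suc-oneMoreAt x m)) (cong (w x +_) m-sol)

IsSol-oneMoreAt : ∀ {n} (w : Fin n → ℕ) {x : Fin n} {c : ℕ} (σ : Permutation′ n) {u v : Fin n → ℕ} →
                  OneMoreAt x u v → IsSol w (w x + c) σ u → IsSol w c σ v
IsSol-oneMoreAt w {x} σ {u} {v} u≻v (u-sol , u-least) = v-sol , v-least
  where
  v-sol : IsSolution w _ v
  v-sol = +-cancelˡ-≡ (w x) _ _ (trans (sym (weighted-oneMoreAt w u≻v)) u-sol)

  v-least : ∀ m → IsSolution w _ m → (∀ i → m i ≡ v i) ⊎ LexSmaller σ v m
  v-least m m-sol with u-least (updateAt m x suc) (proj₂ (Feasible-+ w x (m , m-sol)))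
  ... | inj₁ m⁺≗u  = inj₁ (λ i → oneMoreAt-≡ (updateAt-suc-oneMoreAt x m) u≻v i (m⁺≗u i))
  ... | inj₂ u<m⁺ = inj₂ (LexSmaller-oneMoreAt u≻v (updateAt-suc-oneMoreAt x m) σ u<m⁺)

%-cong-+ˡ : ∀ a {x y} d .{{_ : NonZero d}} → x % d ≡ y % d → (a + x) % d ≡ (a + y) % d
%-cong-+ˡ a {x} {y} d x≡y = begin
  (a + x) % d             ≡⟨ %-distribˡ-+ a x d ⟩
  (a % d + x % d) % d     ≡⟨ cong (λ z → (a % d + z) % d) x≡y ⟩
  (a % d + y % d) % d     ≡⟨ %-distribˡ-+ a y d ⟨
  (a + y) % d             ∎
  where open ≡-Reasoning

m+n*[1+o]∸n≡m+n*o : ∀ m n o → m + n * suc o ∸ n ≡ m + n * o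
m+n*[1+o]∸n≡m+n*o m n o = begin
  m + n * suc o ∸ n     ≡⟨ +-∸-assoc m (m≤m*n n (suc o)) ⟩
  m + (n * suc o ∸ n)   ≡⟨ cong (λ z → m + (z ∸ n)) (*-suc n o) ⟩
  m + (n + n * o ∸ n)   ≡⟨ cong (m +_) (m+n∸m≡n n (n * o)) ⟩
  m + n * o             ∎
  where open ≡-Reasoning

-- r + a * W ∸ a is r − a moved up by a multiple of W, so the truncated
-- subtraction never cuts off.
residue-shift : ∀ W (p : 0 < W) a {r} j → r < W →
                mod (a + j) W p ≡ r ⇔ mod j W p ≡ mod (r + a * W ∸ a) W p
residue-shift (suc b) p a {r} j r<W rewrite m+n*[1+o]∸n≡m+n*o r a b =
  mk⇔ unshift shift
  where
  W : ℕ
  W = suc b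
  t : ℕ
  t = r + a * b

  a+t≡r : (a + t) % W ≡ r
  a+t≡r = begin
    (a + (r + a * b)) % W ≡⟨ cong (_% W) (x∙yz≈y∙xz a r (a * b)) ⟩
    (r + (a + a * b)) % W ≡⟨ cong (λ z → (r + z) % W) (*-suc a b) ⟨
    (r + a * W) % W       ≡⟨ [m+kn]%n≡m%n r a W ⟩
    r % W                 ≡⟨ m<n⇒m%n≡m r<W ⟩
    r                     ∎
    where open ≡-Reasoning

  a*b+[a+y]%≡y% : ∀ y → (a * b + (a + y)) % W ≡ y % W
  a*b+[a+y]%≡y% y = begin
    (a * b + (a + y)) % W ≡⟨ cong (_% W) (x∙yz≈z∙yx (a * b) a y) ⟩
    (y + (a + a * b)) % W ≡⟨ cong (λ z → (y + z) % W) (*-suc a b) ⟨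
    (y + a * W) % W       ≡⟨ [m+kn]%n≡m%n y a W ⟩
    y % W                 ∎
    where open ≡-Reasoning

  unshift : (a + j) % W ≡ r → j % W ≡ t % W
  unshift a+j≡r = begin
    j % W                 ≡⟨ a*b+[a+y]%≡y% j ⟨
    (a * b + (a + j)) % W ≡⟨ %-cong-+ˡ (a * b) W (trans a+j≡r (sym a+t≡r)) ⟩
    (a * b + (a + t)) % W ≡⟨ a*b+[a+y]%≡y% t ⟩
    t % W                 ∎
    where open ≡-Reasoning

  shift : j % W ≡ t % W → (a + j) % W ≡ r
  shift j≡t = trans (%-cong-+ˡ a W j≡t) a+t≡r

lemma10 : ∀ {k} (w : Fin (suc k) → ℕ) (pos : ∀ i → 0 < w i) (σ : Permutation′ (suc k))
          (r : ℕ) → r < w zero → (u : Fin (suc k) → ℕ) → IsSolM w (pos zero) r σ u →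
          (x : Fin (suc k)) → 0 < u x →
          IsSolM w (pos zero) (mod ((r + w x * w zero) ∸ w x) (w zero) (pos zero)) σ
            (decAt x u)
lemma10 w pos σ r r<w₁ u (j , j≡r , _ , j-least , u-sol) x 0<ux =
  j′ , to (shift j′) (subst (λ c → mod c (w zero) (pos zero) ≡ r) j≡wx+j′ j≡r) , (v , refl) ,
  j′-least , IsSol-oneMoreAt w σ u≻v (subst (λ c → IsSol w c σ u) j≡wx+j′ u-sol)
  where
  open Equivalence
  v : Fin _ → ℕ
  v = decAt x u
  u≻v : OneMoreAt x u v
  u≻v = decAt-oneMoreAt x u 0<ux
  j′ : ℕ
  j′ = weighted w v

  j≡wx+j′ : j ≡ w x + j′
  j≡wx+j′ = trans (sym (proj₁ u-sol)) (weighted-oneMoreAt w u≻v)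

  shift : ∀ i → mod (w x + i) (w zero) (pos zero) ≡ r ⇔
                mod i (w zero) (pos zero) ≡ mod (r + w x * w zero ∸ w x) (w zero) (pos zero)
  shift i = residue-shift (w zero) (pos zero) (w x) i r<w₁

  j′-least : ∀ i → i < j′ → mod i (w zero) (pos zero) ≡ mod (r + w x * w zero ∸ w x) (w zero) (pos zero) →
             ¬ Feasible w i
  j′-least i i<j′ i≡ i-feasible =
    j-least (w x + i) (subst (w x + i <_) (sym j≡wx+j′) (+-monoʳ-< (w x) i<j′))
            (from (shift i) i≡) (Feasible-+ w x i-feasible)
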